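{- Let $n\ge 1$ and let $Q=(q_{ij})_{i,j\ge1}$, $T=(t_{ij})_{i,j\ge1}$ be two infinite matrices of commuting indeterminates. Let $\mathcal K_n$ be the $2^{n-1}\times 2^{n-1}$ matrix, with rows and columns indexed by the compositions of $n$ (both listed in the same order), whose entry in row $I$ and column $J$ is $\tilde k_{IJ}(Q,T)=\prod_{d\in \mathrm{Des}(J)} z_d(I)$. Then $$\det \mathcal K_n=\prod_{i+j\le n}(t_{ij}-q_{ij})^{e(i,j)},\qquad e(i,j)=\binom{i+j-2}{i-1}\,2^{\,n-i-j},$$ the product being over pairs of positive integers $(i,j)$ with $i+j\le n$.
   Context: A composition $I=(i_1,\dots,i_r)$ of $n$ has descent set $\mathrm{Des}(I)=\{i_1,i_1+i_2,\dots,i_1+\dots+i_{r-1}\}\subseteq\{1,\dots,n-1\}$; it is encoded by the boolean word $u=u_1\cdots u_{n-1}$ with $u_k=1$ iff $k\in\mathrm{Des}(I)$. For $1\le k\le n-1$, let $a$ (resp. $b$) be the number of letters $1$ (resp. $0$) in the prefix $u_1\cdots u_{k-1}$; define $z_k(I)=q_{a+1,b+1}$ if $u_k=0$ and $z_k(I)=t_{a+1,b+1}$ if $u_k=1$. (Equivalently, in the ribbon diagram of $I$ with cells labelled by matrix coordinates, a cell $(i,j)\neq(1,1)$ gets $q_{i,j-1}$ if it has a cell to its left and $t_{i-1,j}$ if it has a cell above, read in order.) The noncommutative $(Q,T)$-Macdonald function is $\tilde H_I=\sum_{J\vDash n}\tilde k_{IJ}(Q,T)R_J$, $R_J$ the ribbon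 basis of noncommutative symmetric functions, and $\mathcal K_n$ is its Kostka matrix. -}

module Defs where

open import Level using (Level)
open import Data.Bool using (Bool; true; false; if_then_else_)
open import Data.Nat using (ℕ; zero; suc; _∸_; _≤ᵇ_)
import Data.Nat as N
open import Data.Nat.Properties using (+-identityʳ)
open import Data.Nat.Combinatorics using (_C_)
open import Data.Fin using (Fin; zero; suc; toℕ; punchIn)
open import Data.Vec using (Vec; []; _∷_; _++_; cast; lookup)
import Data.Vec as V
open import Data.List using (List; []; _∷_; foldr; concatMap; upTo)
import Data.List as L
open import Data.List.Base using (allFin)
open import Relation.Binary.PropositionalEquality using (_≡_; cong; sym)
open import Algebra.Bundles using (CommutativeRing)
open import Data.Product using (_×_; _,_; proj₁; proj₂)

-- All boolean words of length m (encodings of compositions of m+1),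
-- listed in a fixed order.
allWords : (m : ℕ) → Vec (Vec Bool m) (2 N.^ m)
allWords zero = [] ∷ []
allWords (suc m) =
  cast (cong (2 N.^ m N.+_) (sym (+-identityʳ (2 N.^ m))))
       (V.map (false ∷_) (allWords m) V.++ V.map (true ∷_) (allWords m))

module _ {c ℓ : Level} (R : CommutativeRing c ℓ) where
  open CommutativeRing R using (Carrier; _+_; _*_; -_; _-_; 0#; 1#)

  pow : Carrier → ℕ → Carrier
  pow x zero = 1#
  pow x (suc k) = x * pow x k

  sgn : ℕ → Carrier
  sgn zero = 1#
  sgn (suc k) = - sgn k

  sumL : List Carrier → Carrier
  sumL = foldr _+_ 0#

  prodL : List Carrier → Carrier
  prodL = foldr _*_ 1#

  det : (m : ℕ) → (Fin m → Fin m → Carrier) → Carrier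
  det zero A = 1#
  det (suc m) A =
    sumL (L.map (λ j → sgn (toℕ j) * (A zero j *
                   det m (λ r s → A (suc r) (punchIn j s))))
                (allFin (suc m)))

  -- z-product: given the word u of I (starting with a ones and b zeros
  -- already read) and the word v of J, the product over the positions d
  -- with v_d = 1 of z_d(I); q and t are indexed 1-based: q i j = q_{ij}.
  kEntry : (q t : ℕ → ℕ → Carrier) → (a b : ℕ) → {m : ℕ} →
           Vec Bool m → Vec Bool m → Carrier
  kEntry q t a b [] [] = 1#
  kEntry q t a b (u ∷ us) (v ∷ vs) =
    (if v then (if u then t (suc a) (suc b) else q (suc a) (suc b)) else 1#)
    * (if u then kEntry q t (suc a) b us vs else kEntry q t a (suc b) us vs)

  kTilde : (q t : ℕ → ℕ → Carrier) → {m : ℕ} → Vec Bool m → Vec Bool m → Carrier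
  kTilde q t = kEntry q t 0 0

  -- Kostka matrix K_n for n = m + 1, rows/columns indexed by allWords m
  Kostka : (q t : ℕ → ℕ → Carrier) → (m : ℕ) →
           Fin (2 N.^ m) → Fin (2 N.^ m) → Carrier
  Kostka q t m r s = kTilde q t (lookup (allWords m) r) (lookup (allWords m) s)

  expo : (n i j : ℕ) → ℕ
  expo n i j = ((i N.+ j ∸ 2) C (i ∸ 1)) N.* (2 N.^ (n ∸ (i N.+ j)))

  pairsLe : ℕ → List (ℕ × ℕ)
  pairsLe n = concatMap (λ i → concatMap (λ j →
                 if (suc i N.+ suc j) ≤ᵇ n then (suc i , suc j) ∷ [] else [])
                 (upTo n)) (upTo n)

  rhs : (q t : ℕ → ℕ → Carrier) → ℕ → Carrier
  rhs q t n = prodL (L.map (λ p → pow (t (proj₁ p) (proj₂ p) - q (proj₁ p) (proj₂ p))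
                                       (expo n (proj₁ p) (proj₂ p)))
                           (pairsLe n))

-- Order the words by their first letter. Let K(a,b,m) be the Kostka matrix of the words of length m,
-- all entries read as if a letters 1 and b letters 0 had already been read. Then K(a,b,m+1) has the block
-- form [[A, qA], [B, tB]] with A = K(a,b+1,m), B = K(a+1,b,m), q = q_{a+1,b+1} and t = t_{a+1,b+1}.
-- Subtracting q times each left column from the matching right column leaves a block triangular matrix,
-- so det K(a,b,m+1) = (t - q)^(2^m) det A det B. Unwinding this recursion, the exponent of
-- t_{a+1+i,b+1+j} - q_{a+1+i,b+1+j} obeys Pascal's rule with an extra factor 2 per level, which gives
-- C(i+j,i) 2^(m-1-i-j).

module Submission where

open import Defs
open import Level using (Level)
open import Data.Nat using (ℕ; _≤_; _∸_)
open import Algebra.Bundles using (CommutativeRing)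

open import Data.Bool using (Bool; true; false; if_then_else_; T)
open import Data.Empty using (⊥-elim)
open import Data.Fin as Fin using (Fin; zero; suc; toℕ; punchIn; punchOut; inject₁; _↑ˡ_; _↑ʳ_; splitAt; fromℕ<)
import Data.Fin.Properties as Finₚ
open import Data.List as List using (List; []; _∷_; _++_; concatMap; applyUpTo)
open import Data.Nat as ℕ using (zero; suc; z≤n; s≤s; _<_; _<?_; _≤ᵇ_)
open import Data.Nat.Combinatorics using (nCn≡1; nCk+nC[k+1]≡[n+1]C[k+1]) renaming (_C_ to _choose_)
import Data.Nat.Properties as ℕₚ
open import Data.Product using (∃; _×_; _,_; proj₁; proj₂)
open import Data.Unit using (tt)
open import Data.Sum using (_⊎_; inj₁; inj₂; [_,_]′)
import Data.Vec as Vec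
import Data.Vec.Properties as Vecₚ
open import Data.Vec.Functional using (removeAt)
open import Function using (_∘_; mk⇔)
open import Relation.Binary.PropositionalEquality as ≡ using (_≡_; _≢_; cong; cong₂)
open import Relation.Nullary using (¬_; Dec; yes; no; does)
open import Relation.Nullary.Decidable using (dec-true; dec-false; does-⇔)
open import Relation.Binary.Definitions using (tri<; tri≈; tri>)

toℕ-punchIn-cases : ∀ {m} (p : Fin (suc m)) (x : Fin m) →
  (toℕ x < toℕ p × toℕ (punchIn p x) ≡ toℕ x) ⊎ (toℕ p ≤ toℕ x × toℕ (punchIn p x) ≡ suc (toℕ x))
toℕ-punchIn-cases zero x = inj₂ (z≤n , ≡.refl)
toℕ-punchIn-cases (suc p) zero = inj₁ (s≤s z≤n , ≡.refl)
toℕ-punchIn-cases (suc p) (suc x) with toℕ-punchIn-cases p x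
... | inj₁ (x<p , eq) = inj₁ (s≤s x<p , cong suc eq)
... | inj₂ (p≤x , eq) = inj₂ (s≤s p≤x , cong suc eq)

punchIn-reflects-adjacent : ∀ {m} (p : Fin (suc m)) (x y : Fin m) →
  toℕ (punchIn p y) ≡ suc (toℕ (punchIn p x)) → toℕ y ≡ suc (toℕ x)
punchIn-reflects-adjacent p x y adj with toℕ-punchIn-cases p x | toℕ-punchIn-cases p y
... | inj₁ (_ , ex) | inj₁ (_ , ey) = ≡.trans (≡.sym ey) (≡.trans adj (cong suc ex))
... | inj₂ (_ , ex) | inj₂ (_ , ey) = ℕₚ.suc-injective (≡.trans (≡.sym ey) (≡.trans adj (cong suc ex)))
... | inj₁ (x<p , ex) | inj₂ (p≤y , ey) =
  ⊥-elim (ℕₚ.<-irrefl (≡.sym (ℕₚ.suc-injective (≡.trans (≡.sym ey) (≡.trans adj (cong suc ex)))))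
                      (ℕₚ.<-≤-trans x<p p≤y))
... | inj₂ (p≤x , ex) | inj₁ (y<p , ey) =
  ⊥-elim (ℕₚ.<-asym (ℕₚ.<-≤-trans y<p p≤x)
    (≡.subst (toℕ x <_) (≡.sym (≡.trans (≡.sym ey) (≡.trans adj (cong suc ex)))) (ℕₚ.m<n⇒m<1+n (ℕₚ.n<1+n _))))

-- The minors obtained by deleting either of two adjacent columns i, j differ only where one of
-- them shows column j and the other column i.
punchIn-adjacent : ∀ {m} (i j : Fin (suc m)) (s : Fin m) → toℕ j ≡ suc (toℕ i) →
  (punchIn i s ≡ punchIn j s) ⊎ (punchIn i s ≡ j × punchIn j s ≡ i)
punchIn-adjacent i j s j≡1+i with toℕ-punchIn-cases i s | toℕ-punchIn-cases j s
... | inj₁ (_ , ei) | inj₁ (_ , ej) = inj₁ (Finₚ.toℕ-injective (≡.trans ei (≡.sym ej)))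
... | inj₂ (_ , ei) | inj₂ (_ , ej) = inj₁ (Finₚ.toℕ-injective (≡.trans ei (≡.sym ej)))
... | inj₁ (s<i , _) | inj₂ (j≤s , _) = ⊥-elim (ℕₚ.<-asym s<i (≡.subst (_≤ toℕ s) j≡1+i j≤s))
... | inj₂ (i≤s , ei) | inj₁ (s<j , ej) =
  inj₂ (Finₚ.toℕ-injective (≡.trans ei (≡.trans (cong suc s≡i) (≡.sym j≡1+i))) ,
        Finₚ.toℕ-injective (≡.trans ej s≡i))
  where
  s≡i : toℕ s ≡ toℕ i
  s≡i = ℕₚ.≤-antisym (ℕₚ.m<1+n⇒m≤n (≡.subst (toℕ s <_) j≡1+i s<j)) i≤s

punchIn-↑ˡ : ∀ {k} l (i : Fin (suc k)) (j : Fin k) → punchIn (i ↑ˡ l) (j ↑ˡ l) ≡ punchIn i j ↑ˡ l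
punchIn-↑ˡ l zero j = ≡.refl
punchIn-↑ˡ l (suc i) zero = ≡.refl
punchIn-↑ˡ l (suc i) (suc j) = cong suc (punchIn-↑ˡ l i j)

punchIn-↑ʳ : ∀ k {l} (i : Fin (suc k)) (j : Fin l) → punchIn (i ↑ˡ l) (k ↑ʳ j) ≡ suc k ↑ʳ j
punchIn-↑ʳ k zero j = ≡.refl
punchIn-↑ʳ zero (suc ()) j
punchIn-↑ʳ (suc k) (suc i) j = cong suc (punchIn-↑ʳ k i j)

↑ʳ≢↑ˡ : ∀ {m n} (i : Fin n) (j : Fin m) → m ↑ʳ i ≢ j ↑ˡ n
↑ʳ≢↑ˡ {m} {n} i j eq
  with ≡.trans (≡.sym (Finₚ.splitAt-↑ʳ m n i)) (≡.trans (cong (splitAt m) eq) (Finₚ.splitAt-↑ˡ m j n))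
... | ()

↑-cases : ∀ m {n} (s : Fin (m ℕ.+ n)) → (∃ λ i → s ≡ i ↑ˡ n) ⊎ (∃ λ j → s ≡ m ↑ʳ j)
↑-cases m {n} s with splitAt m s in eq
... | inj₁ i = inj₁ (i , ≡.sym (Finₚ.splitAt⁻¹-↑ˡ eq))
... | inj₂ j = inj₂ (j , ≡.sym (Finₚ.splitAt⁻¹-↑ʳ eq))

<-suc-≢ : ∀ {m k} → m ≢ k → does (m <? suc k) ≡ does (m <? k)
<-suc-≢ {m} {k} m≢k =
  does-⇔ (mk⇔ (λ m<1+k → ℕₚ.≤∧≢⇒< (ℕₚ.m<1+n⇒m≤n m<1+k) m≢k) ℕₚ.m<n⇒m<1+n) (m <? suc k) (m <? k)

module Determinant {c ℓ : Level} (R : CommutativeRing c ℓ) where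
  open CommutativeRing R hiding (zero)
  open import Algebra.Properties.Ring ring using (-‿distribˡ-*; -‿involutive; -0#≈0#; +-inverseʳ-unique; [y-z]x≈yx-zx)
  open import Algebra.Properties.Semiring.Sum semiring
    using (sum; sum-cong-≋; sum-remove; sum-replicate-zero; ∑-distrib-+; *-distribˡ-sum; *-distribʳ-sum)
  open import Algebra.Solver.Ring.NaturalCoefficients.Default commutativeSemiring
    using (solve; _:=_; _:+_; _:*_)
  open import Relation.Binary.Reasoning.Setoid setoid

  sum-zero : ∀ {n} {f : Fin n → Carrier} → (∀ i → f i ≈ 0#) → sum f ≈ 0#
  sum-zero {n} f≈0 = trans (sum-cong-≋ f≈0) (sum-replicate-zero n)

  sum-one : ∀ {n} (f : Fin n → Carrier) (i : Fin n) → (∀ p → p ≢ i → f p ≈ 0#) → sum f ≈ f i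
  sum-one {suc n} f i others = begin
    sum f                     ≈⟨ sum-remove {i = i} f ⟩
    f i + sum (removeAt f i)  ≈⟨ +-congˡ (sum-zero (λ p → others _ (Finₚ.punchInᵢ≢i i p))) ⟩
    f i + 0#                  ≈⟨ +-identityʳ _ ⟩
    f i                       ∎

  sum-two : ∀ {n} (f : Fin n → Carrier) {i j : Fin n} → i ≢ j →
            (∀ p → p ≢ i → p ≢ j → f p ≈ 0#) → sum f ≈ f i + f j
  sum-two {suc n} f {i} {j} i≢j others = begin
    sum f                               ≈⟨ sum-remove {i = i} f ⟩
    f i + sum (removeAt f i)            ≈⟨ +-congˡ (sum-one (removeAt f i) (punchOut i≢j) others′) ⟩
    f i + f (punchIn i (punchOut i≢j))  ≡⟨ cong (λ p → f i + f p) (Finₚ.punchIn-punchOut i≢j) ⟩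
    f i + f j                           ∎
    where
    others′ : ∀ p → p ≢ punchOut i≢j → f (punchIn i p) ≈ 0#
    others′ p p≢ = others _ (Finₚ.punchInᵢ≢i i p) λ eq →
      p≢ (Finₚ.punchIn-injective i p _ (≡.trans eq (≡.sym (Finₚ.punchIn-punchOut i≢j))))

  sum-↑ : ∀ k {l} (f : Fin (k ℕ.+ l) → Carrier) → sum f ≈ sum (λ i → f (i ↑ˡ l)) + sum (λ j → f (k ↑ʳ j))
  sum-↑ zero f = sym (+-identityˡ _)
  sum-↑ (suc k) f = trans (+-congˡ (sum-↑ k (f ∘ suc))) (sym (+-assoc _ _ _))

  Mat : ℕ → Set c
  Mat n = Fin n → Fin n → Carrier

  minor : ∀ {m} → Fin (suc m) → Mat (suc m) → Mat m
  minor j A r s = A (suc r) (punchIn j s)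

  expansionTerm : ∀ {m} → Mat (suc m) → Fin (suc m) → Carrier
  expansionTerm {m} A j = sgn R (toℕ j) * (A zero j * det R m (minor j A))

  expansionTerm-cong : ∀ {m} {A B : Mat (suc m)} j → A zero j ≈ B zero j →
                       det R m (minor j A) ≈ det R m (minor j B) → expansionTerm A j ≈ expansionTerm B j
  expansionTerm-cong j a≈b minor≈ = *-congˡ (*-cong a≈b minor≈)

  sumL-map-tabulate : ∀ {X : Set} {n} (h : X → Carrier) (f : Fin n → X) →
                      sumL R (List.map h (List.tabulate f)) ≡ sum (h ∘ f)
  sumL-map-tabulate {n = zero} h f = ≡.refl
  sumL-map-tabulate {n = suc n} h f = cong (h (f zero) +_) (sumL-map-tabulate h (f ∘ suc))

  det-expand : ∀ {m} (A : Mat (suc m)) → det R (suc m) A ≡ sum (expansionTerm A)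
  det-expand A = sumL-map-tabulate (expansionTerm A) (λ j → j)

  det-cong : ∀ {n} {A B : Mat n} → (∀ r s → A r s ≈ B r s) → det R n A ≈ det R n B
  det-cong {zero} A≈B = refl
  det-cong {suc m} {A} {B} A≈B = begin
    det R (suc m) A        ≡⟨ det-expand A ⟩
    sum (expansionTerm A)  ≈⟨ sum-cong-≋ (λ j → expansionTerm-cong {A = A} {B} j (A≈B zero j)
                                                 (det-cong (λ r s → A≈B (suc r) (punchIn j s)))) ⟩
    sum (expansionTerm B)  ≡⟨ ≡.sym (det-expand B) ⟩
    det R (suc m) B        ∎

  -- The terms of columns i and j cancel: equal entries, equal minors, opposite signs. The other
  -- minors still have two equal adjacent columns.
  det-equal-adjacent-cols : ∀ {n} (A : Mat n) {i j : Fin n} → toℕ j ≡ suc (toℕ i) →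
                            (∀ r → A r i ≈ A r j) → det R n A ≈ 0#
  det-equal-adjacent-cols {suc m} A {i} {j} j≡1+i cols = begin
    det R (suc m) A                           ≡⟨ det-expand A ⟩
    sum (expansionTerm A)                     ≈⟨ sum-two (expansionTerm A) i≢j others ⟩
    expansionTerm A i + expansionTerm A j     ≈⟨ +-congˡ (*-cong (reflexive (cong (sgn R) j≡1+i))
                                                                 (*-cong (sym (cols zero)) (det-cong minorʲ≈minorⁱ))) ⟩
    sgn R (toℕ i) * a + - sgn R (toℕ i) * a   ≈⟨ +-congˡ (sym (-‿distribˡ-* _ a)) ⟩
    sgn R (toℕ i) * a + - (sgn R (toℕ i) * a) ≈⟨ -‿inverseʳ _ ⟩
    0#                                        ∎
    where
    a : Carrier
    a = A zero i * det R m (minor i A)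
    i≢j : i ≢ j
    i≢j i≡j = ℕₚ.1+n≢n (≡.sym (≡.trans (cong toℕ i≡j) j≡1+i))
    minorʲ≈minorⁱ : ∀ r s → minor j A r s ≈ minor i A r s
    minorʲ≈minorⁱ r s with punchIn-adjacent i j s j≡1+i
    ... | inj₁ same = reflexive (cong (A (suc r)) (≡.sym same))
    ... | inj₂ (i′≡j , j′≡i) =
      trans (reflexive (cong (A (suc r)) j′≡i)) (trans (cols (suc r)) (reflexive (cong (A (suc r)) (≡.sym i′≡j))))
    others : ∀ p → p ≢ i → p ≢ j → expansionTerm A p ≈ 0#
    others p p≢i p≢j =
      trans (*-congˡ (*-congˡ (det-equal-adjacent-cols (minor p A) adjacent colsᵖ)))
            (trans (*-congˡ (zeroʳ _)) (zeroʳ _))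
      where
      pi≡i = Finₚ.punchIn-punchOut p≢i
      pj≡j = Finₚ.punchIn-punchOut p≢j
      adjacent : toℕ (punchOut p≢j) ≡ suc (toℕ (punchOut p≢i))
      adjacent = punchIn-reflects-adjacent p _ _
        (≡.trans (cong toℕ pj≡j) (≡.trans j≡1+i (cong (suc ∘ toℕ) (≡.sym pi≡i))))
      colsᵖ : ∀ r → minor p A r (punchOut p≢i) ≈ minor p A r (punchOut p≢j)
      colsᵖ r = trans (reflexive (cong (A (suc r)) pi≡i))
                      (trans (cols (suc r)) (reflexive (cong (A (suc r)) (≡.sym pj≡j))))

  det-linear-col : ∀ {n} (A B C : Mat n) (c : Fin n) (x : Carrier) →
    (∀ r s → s ≢ c → A r s ≈ B r s) → (∀ r s → s ≢ c → A r s ≈ C r s) →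
    (∀ r → A r c ≈ B r c + x * C r c) → det R n A ≈ det R n B + x * det R n C
  det-linear-col {suc m} A B C c x A≈B A≈C col = begin
    det R (suc m) A                                            ≡⟨ det-expand A ⟩
    sum (expansionTerm A)                                      ≈⟨ sum-cong-≋ term ⟩
    sum (λ p → expansionTerm B p + x * expansionTerm C p)      ≈⟨ ∑-distrib-+ (expansionTerm B) (λ p → x * expansionTerm C p) ⟩
    sum (expansionTerm B) + sum (λ p → x * expansionTerm C p)  ≈⟨ +-congˡ (sym (*-distribˡ-sum x (expansionTerm C))) ⟩
    sum (expansionTerm B) + x * sum (expansionTerm C)          ≡⟨ cong₂ (λ b c → b + x * c) (≡.sym (det-expand B))
                                                                                             (≡.sym (det-expand C)) ⟩
    det R (suc m) B + x * det R (suc m) C                      ∎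
    where
    term : ∀ p → expansionTerm A p ≈ expansionTerm B p + x * expansionTerm C p
    term p with p Fin.≟ c
    ... | yes ≡.refl = begin
      s * (A zero p * dA)                  ≈⟨ *-congˡ (*-cong (col zero) dA≈dB) ⟩
      s * ((B zero p + x * C zero p) * dB)
        ≈⟨ solve 5 (λ s b x c d → s :* ((b :+ x :* c) :* d) := s :* (b :* d) :+ x :* (s :* (c :* d)))
                   refl s (B zero p) x (C zero p) dB ⟩
      s * (B zero p * dB) + x * (s * (C zero p * dB)) ≈⟨ +-congˡ (*-congˡ (*-congˡ (*-congˡ dB≈dC))) ⟩
      s * (B zero p * dB) + x * (s * (C zero p * det R m (minor p C))) ∎
      where
      s = sgn R (toℕ p)
      dA = det R m (minor p A)
      dB = det R m (minor p B)
      dA≈dB : dA ≈ dB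
      dA≈dB = det-cong (λ r s → A≈B (suc r) (punchIn p s) (Finₚ.punchInᵢ≢i p s))
      dB≈dC : dB ≈ det R m (minor p C)
      dB≈dC = trans (sym dA≈dB) (det-cong (λ r s → A≈C (suc r) (punchIn p s) (Finₚ.punchInᵢ≢i p s)))
    ... | no p≢c = begin
      s * (A zero p * dA)                                  ≈⟨ *-congˡ (*-congˡ minor-linear) ⟩
      s * (A zero p * (dB + x * dC))
        ≈⟨ solve 5 (λ s a b x c → s :* (a :* (b :+ x :* c)) := s :* (a :* b) :+ x :* (s :* (a :* c)))
                   refl s (A zero p) dB x dC ⟩
      s * (A zero p * dB) + x * (s * (A zero p * dC))      ≈⟨ +-cong (*-congˡ (*-congʳ (A≈B zero p p≢c)))
                                                                     (*-congˡ (*-congˡ (*-congʳ (A≈C zero p p≢c)))) ⟩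
      s * (B zero p * dB) + x * (s * (C zero p * dC))      ∎
      where
      s = sgn R (toℕ p)
      dA = det R m (minor p A)
      dB = det R m (minor p B)
      dC = det R m (minor p C)
      pc≡c = Finₚ.punchIn-punchOut p≢c
      off : ∀ s → s ≢ punchOut p≢c → punchIn p s ≢ c
      off s s≢ eq = s≢ (Finₚ.punchIn-injective p s _ (≡.trans eq (≡.sym pc≡c)))
      minor-linear : dA ≈ dB + x * dC
      minor-linear = det-linear-col (minor p A) (minor p B) (minor p C) (punchOut p≢c) x
        (λ r s s≢ → A≈B (suc r) (punchIn p s) (off s s≢))
        (λ r s s≢ → A≈C (suc r) (punchIn p s) (off s s≢))
        (λ r → ≡.subst (λ z → A (suc r) z ≈ B (suc r) z + x * C (suc r) z) (≡.sym pc≡c) (col (suc r)))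

  setCol : ∀ {n} → Mat n → Fin n → (Fin n → Carrier) → Mat n
  setCol A c v r s with s Fin.≟ c
  ... | yes _ = v r
  ... | no _  = A r s

  setCol-≡ : ∀ {n} (A : Mat n) c {s} v r → s ≡ c → setCol A c v r s ≡ v r
  setCol-≡ A c v r ≡.refl with c Fin.≟ c
  ... | yes _   = ≡.refl
  ... | no c≢c = ⊥-elim (c≢c ≡.refl)

  setCol-≢ : ∀ {n} (A : Mat n) {c s} v r → s ≢ c → setCol A c v r s ≡ A r s
  setCol-≢ A {c} {s} v r s≢c with s Fin.≟ c
  ... | yes s≡c = ⊥-elim (s≢c s≡c)
  ... | no _    = ≡.refl

  setCol-id : ∀ {n} (A : Mat n) c v → (∀ r → v r ≡ A r c) → ∀ r s → setCol A c v r s ≡ A r s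
  setCol-id A c v v≡ r s with s Fin.≟ c
  ... | yes ≡.refl = v≡ r
  ... | no _       = ≡.refl

  setCol-comm : ∀ {n} (A : Mat n) {i j} x y → i ≢ j →
                ∀ r s → setCol (setCol A i x) j y r s ≡ setCol (setCol A j y) i x r s
  setCol-comm A {i} {j} x y i≢j r s = cases (s Fin.≟ i) (s Fin.≟ j)
    where
    cases : Dec (s ≡ i) → Dec (s ≡ j) → setCol (setCol A i x) j y r s ≡ setCol (setCol A j y) i x r s
    cases (yes s≡i) _ =
      ≡.trans (setCol-≢ _ y r (i≢j ∘ ≡.trans (≡.sym s≡i)))
              (≡.trans (setCol-≡ A i x r s≡i) (≡.sym (setCol-≡ _ i x r s≡i)))
    cases (no s≢i) (yes s≡j) =
      ≡.trans (setCol-≡ _ j y r s≡j) (≡.sym (≡.trans (setCol-≢ _ x r s≢i) (setCol-≡ A j y r s≡j)))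
    cases (no s≢i) (no s≢j) =
      ≡.trans (setCol-≢ _ y r s≢j) (≡.trans (setCol-≢ A x r s≢i)
        (≡.sym (≡.trans (setCol-≢ _ x r s≢i) (setCol-≢ A y r s≢j))))

  det-additive-col : ∀ {n} (M : Mat n) c (x y : Fin n → Carrier) →
    det R n (setCol M c (λ r → x r + y r)) ≈ det R n (setCol M c x) + det R n (setCol M c y)
  det-additive-col M c x y = trans (det-linear-col _ _ _ c 1# off off col) (+-congˡ (*-identityˡ _))
    where
    off : ∀ {v w} r s → s ≢ c → setCol M c v r s ≈ setCol M c w r s
    off r s s≢c = reflexive (≡.trans (setCol-≢ M _ r s≢c) (≡.sym (setCol-≢ M _ r s≢c)))
    col : ∀ r → setCol M c (λ r → x r + y r) r c ≈ setCol M c x r c + 1# * setCol M c y r c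
    col r = begin
      setCol M c (λ r → x r + y r) r c      ≡⟨ setCol-≡ M c _ r ≡.refl ⟩
      x r + y r                             ≈⟨ +-congˡ (sym (*-identityˡ _)) ⟩
      x r + 1# * y r                        ≡⟨ ≡.sym (cong₂ (λ a b → a + 1# * b) (setCol-≡ M c x r ≡.refl)
                                                                             (setCol-≡ M c y r ≡.refl)) ⟩
      setCol M c x r c + 1# * setCol M c y r c ∎

  -- Expand det with columns i, j both set to u + v (which is 0) bilinearly.
  det-swap-adjacent-cols : ∀ {n} (A : Mat n) {i j : Fin n} → toℕ j ≡ suc (toℕ i) →
    det R n (setCol (setCol A i (λ r → A r j)) j (λ r → A r i)) ≈ - det R n A
  det-swap-adjacent-cols {n} A {i} {j} j≡1+i = +-inverseʳ-unique _ _ (begin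
    det R n A + D v u            ≈⟨ +-congʳ (sym Duv≈A) ⟩
    D u v + D v u                ≈⟨ +-cong (sym (+-identityˡ _)) (sym (+-identityʳ _)) ⟩
    (0# + D u v) + (D v u + 0#)  ≈⟨ +-cong (+-congʳ (sym (D-diag u))) (+-congˡ (sym (D-diag v))) ⟩
    (D u u + D u v) + (D v u + D v v) ≈⟨ sym (+-cong (D-additiveʳ u u v) (D-additiveʳ v u v)) ⟩
    D u w + D v w                ≈⟨ sym (D-additiveˡ u v w) ⟩
    D w w                        ≈⟨ D-diag w ⟩
    0#                           ∎)
    where
    i≢j : i ≢ j
    i≢j i≡j = ℕₚ.1+n≢n (≡.sym (≡.trans (cong toℕ i≡j) j≡1+i))
    u v w : Fin n → Carrier
    u r = A r i
    v r = A r j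
    w r = u r + v r
    D : (Fin n → Carrier) → (Fin n → Carrier) → Carrier
    D x y = det R n (setCol (setCol A i x) j y)
    D-additiveʳ : ∀ x y y′ → D x (λ r → y r + y′ r) ≈ D x y + D x y′
    D-additiveʳ x = det-additive-col (setCol A i x) j
    D-additiveˡ : ∀ x x′ y → D (λ r → x r + x′ r) y ≈ D x y + D x′ y
    D-additiveˡ x x′ y = begin
      D (λ r → x r + x′ r) y                                     ≈⟨ det-cong (comm _) ⟩
      det R n (setCol (setCol A j y) i (λ r → x r + x′ r))       ≈⟨ det-additive-col (setCol A j y) i x x′ ⟩
      det R n (setCol (setCol A j y) i x) + det R n (setCol (setCol A j y) i x′)
                                                                 ≈⟨ sym (+-cong (det-cong (comm x)) (det-cong (comm x′))) ⟩
      D x y + D x′ y                                             ∎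
      where
      comm : ∀ z r s → setCol (setCol A i z) j y r s ≈ setCol (setCol A j y) i z r s
      comm z r s = reflexive (setCol-comm A z y i≢j r s)
    D-diag : ∀ x → D x x ≈ 0#
    D-diag x = det-equal-adjacent-cols _ j≡1+i λ r →
      reflexive (≡.trans (≡.trans (setCol-≢ _ x r i≢j) (setCol-≡ A i x r ≡.refl)) (≡.sym (setCol-≡ _ j x r ≡.refl)))
    Duv≈A : D u v ≈ det R n A
    Duv≈A = det-cong λ r s → reflexive (≡.trans
      (setCol-id (setCol A i u) j v (λ r → ≡.sym (setCol-≢ A u r (i≢j ∘ ≡.sym))) r s)
      (setCol-id A i u (λ _ → ≡.refl) r s))

  -- Swapping column j with its left neighbour e brings the copy of column i one step closer.
  det-equal-cols-gap : ∀ d {n} (A : Mat n) {i j : Fin n} → suc (toℕ i ℕ.+ d) ≡ toℕ j →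
                       (∀ r → A r i ≈ A r j) → det R n A ≈ 0#
  det-equal-cols-gap zero A gap cols =
    det-equal-adjacent-cols A (≡.trans (≡.sym gap) (cong suc (ℕₚ.+-identityʳ _))) cols
  det-equal-cols-gap (suc d) A {j = zero} () cols
  det-equal-cols-gap (suc d) {suc n} A {i} {suc j} gap cols = begin
    det R (suc n) A        ≈⟨ sym (-‿involutive _) ⟩
    - - det R (suc n) A    ≈⟨ -‿cong (sym (det-swap-adjacent-cols A e-adjacent)) ⟩
    - det R (suc n) B      ≈⟨ -‿cong (det-equal-cols-gap d B gapᴮ colsᴮ) ⟩
    - 0#                   ≈⟨ -0#≈0# ⟩
    0#                     ∎
    where
    e = inject₁ j
    e-adjacent : toℕ (suc j) ≡ suc (toℕ e)
    e-adjacent = cong suc (≡.sym (Finₚ.toℕ-inject₁ j))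
    B = setCol (setCol A e (λ r → A r (suc j))) (suc j) (λ r → A r e)
    gapᴮ : suc (toℕ i ℕ.+ d) ≡ toℕ e
    gapᴮ = ≡.trans (≡.sym (ℕₚ.+-suc (toℕ i) d))
                   (≡.trans (ℕₚ.suc-injective gap) (≡.sym (Finₚ.toℕ-inject₁ j)))
    i<e : toℕ i < toℕ e
    i<e = ≡.subst (toℕ i <_) gapᴮ (s≤s (ℕₚ.m≤m+n (toℕ i) d))
    e≢j : e ≢ suc j
    e≢j e≡j = ℕₚ.1+n≢n (≡.sym (≡.trans (cong toℕ e≡j) e-adjacent))
    colsᴮ : ∀ r → B r i ≈ B r e
    colsᴮ r = trans (reflexive Bri≡Ari) (trans (cols r) (sym (reflexive Bre≡Arj)))
      where
      i≢j : i ≢ suc j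
      i≢j i≡j = ℕₚ.<-asym (≡.subst (_< toℕ e) (cong toℕ i≡j) i<e)
                          (≡.subst (toℕ e <_) (≡.sym e-adjacent) (ℕₚ.n<1+n _))
      Bri≡Ari : B r i ≡ A r i
      Bri≡Ari = ≡.trans (setCol-≢ _ _ r i≢j) (setCol-≢ A _ r λ i≡e → ℕₚ.<-irrefl (cong toℕ i≡e) i<e)
      Bre≡Arj : B r e ≡ A r (suc j)
      Bre≡Arj = ≡.trans (setCol-≢ _ _ r e≢j) (setCol-≡ A e _ r ≡.refl)

  det-equal-cols : ∀ {n} (A : Mat n) {i j : Fin n} → i ≢ j → (∀ r → A r i ≈ A r j) → det R n A ≈ 0#
  det-equal-cols A {i} {j} i≢j cols with ℕₚ.<-cmp (toℕ i) (toℕ j)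
  ... | tri< i<j _ _ = let d , gap = ℕₚ.m≤n⇒∃[o]m+o≡n i<j in det-equal-cols-gap d A gap cols
  ... | tri≈ _ i≡j _ = ⊥-elim (i≢j (Finₚ.toℕ-injective i≡j))
  ... | tri> _ _ j<i = let d , gap = ℕₚ.m≤n⇒∃[o]m+o≡n j<i in det-equal-cols-gap d A gap (sym ∘ cols)

  det-subtract-col : ∀ {n} (A A′ : Mat n) {c d : Fin n} (x : Carrier) → c ≢ d →
    (∀ r s → s ≢ c → A′ r s ≈ A r s) → (∀ r → A′ r c ≈ A r c - x * A r d) → det R n A′ ≈ det R n A
  det-subtract-col {n} A A′ {c} {d} x c≢d off col = begin
    det R n A′                ≈⟨ det-linear-col A′ A C c (- x) off off′ col′ ⟩
    det R n A + - x * det R n C ≈⟨ +-congˡ (trans (*-congˡ (det-equal-cols C c≢d colsᶜ)) (zeroʳ _)) ⟩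
    det R n A + 0#            ≈⟨ +-identityʳ _ ⟩
    det R n A                 ∎
    where
    C = setCol A c (λ r → A r d)
    off′ : ∀ r s → s ≢ c → A′ r s ≈ C r s
    off′ r s s≢c = trans (off r s s≢c) (sym (reflexive (setCol-≢ A _ r s≢c)))
    col′ : ∀ r → A′ r c ≈ A r c + - x * C r c
    col′ r = trans (col r) (+-congˡ (trans (-‿distribˡ-* x _) (*-congˡ (sym (reflexive (setCol-≡ A c _ r ≡.refl))))))
    colsᶜ : ∀ r → C r c ≈ C r d
    colsᶜ r = reflexive (≡.trans (setCol-≡ A c _ r ≡.refl) (≡.sym (setCol-≢ A _ r (c≢d ∘ ≡.sym))))

  det-blockTriangular : ∀ k l (M : Mat (k ℕ.+ l)) → (∀ i j → M (i ↑ˡ l) (k ↑ʳ j) ≈ 0#) →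
    det R (k ℕ.+ l) M ≈ det R k (λ i j → M (i ↑ˡ l) (j ↑ˡ l)) * det R l (λ i j → M (k ↑ʳ i) (k ↑ʳ j))
  det-blockTriangular zero l M _ = sym (*-identityˡ _)
  det-blockTriangular (suc k) l M topRight = begin
    det R (suc k ℕ.+ l) M                                 ≡⟨ det-expand M ⟩
    sum (expansionTerm M)                                 ≈⟨ sum-↑ (suc k) (expansionTerm M) ⟩
    sum (λ i → expansionTerm M (i ↑ˡ l)) + sum (λ j → expansionTerm M (suc k ↑ʳ j))
      ≈⟨ +-congˡ (sum-zero λ j → trans (*-congˡ (trans (*-congʳ (topRight zero j)) (zeroˡ _))) (zeroʳ _)) ⟩
    sum (λ i → expansionTerm M (i ↑ˡ l)) + 0#             ≈⟨ +-identityʳ _ ⟩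
    sum (λ i → expansionTerm M (i ↑ˡ l))                  ≈⟨ sum-cong-≋ term ⟩
    sum (λ i → expansionTerm TL i * det R l BR)           ≈⟨ sym (*-distribʳ-sum (det R l BR) (expansionTerm TL)) ⟩
    sum (expansionTerm TL) * det R l BR                   ≡⟨ cong (_* det R l BR) (≡.sym (det-expand TL)) ⟩
    det R (suc k) TL * det R l BR                         ∎
    where
    TL : Mat (suc k)
    TL i j = M (i ↑ˡ l) (j ↑ˡ l)
    BR : Mat l
    BR i j = M (suc k ↑ʳ i) (suc k ↑ʳ j)
    term : ∀ i → expansionTerm M (i ↑ˡ l) ≈ expansionTerm TL i * det R l BR
    term i = begin
      sgn R (toℕ (i ↑ˡ l)) * (TL zero i * det R (k ℕ.+ l) (minor (i ↑ˡ l) M))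
        ≈⟨ *-cong (reflexive (cong (sgn R) (Finₚ.toℕ-↑ˡ i l))) (*-congˡ minorᵢ) ⟩
      sgn R (toℕ i) * (TL zero i * (det R k (minor i TL) * det R l BR))
        ≈⟨ solve 4 (λ s a b c → s :* (a :* (b :* c)) := (s :* (a :* b)) :* c) refl _ _ _ _ ⟩
      expansionTerm TL i * det R l BR ∎
      where
      minorᵢ : det R (k ℕ.+ l) (minor (i ↑ˡ l) M) ≈ det R k (minor i TL) * det R l BR
      minorᵢ = trans
        (det-blockTriangular k l (minor (i ↑ˡ l) M)
          (λ a b → trans (reflexive (cong (M (suc (a ↑ˡ l))) (punchIn-↑ʳ k i b))) (topRight (suc a) b)))
        (*-cong (det-cong λ a b → reflexive (cong (M (suc (a ↑ˡ l))) (punchIn-↑ˡ l i b)))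
                (det-cong λ a b → reflexive (cong (M (suc (k ↑ʳ a))) (punchIn-↑ʳ k i b))))

  det-scale : ∀ {n} x (A : Mat n) → det R n (λ r s → x * A r s) ≈ pow R x n * det R n A
  det-scale {zero} x A = sym (*-identityˡ 1#)
  det-scale {suc m} x A = begin
    det R (suc m) xA                                   ≡⟨ det-expand xA ⟩
    sum (expansionTerm xA)                             ≈⟨ sum-cong-≋ term ⟩
    sum (λ j → pow R x (suc m) * expansionTerm A j)    ≈⟨ sym (*-distribˡ-sum (pow R x (suc m)) (expansionTerm A)) ⟩
    pow R x (suc m) * sum (expansionTerm A)            ≡⟨ cong (pow R x (suc m) *_) (≡.sym (det-expand A)) ⟩
    pow R x (suc m) * det R (suc m) A                  ∎
    where
    xA : Mat (suc m)
    xA r s = x * A r s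
    term : ∀ j → expansionTerm xA j ≈ pow R x (suc m) * expansionTerm A j
    term j = begin
      sgn R (toℕ j) * ((x * A zero j) * det R m (minor j xA))
        ≈⟨ *-congˡ (*-congˡ (det-scale x (minor j A))) ⟩
      sgn R (toℕ j) * ((x * A zero j) * (pow R x m * det R m (minor j A)))
        ≈⟨ solve 5 (λ s x a p d → s :* ((x :* a) :* (p :* d)) := (x :* p) :* (s :* (a :* d))) refl _ _ _ _ _ ⟩
      pow R x (suc m) * expansionTerm A j ∎

  det-cast : ∀ {m n} (eq : m ≡ n) (A : Mat n) → det R m (λ r s → A (Fin.cast eq r) (Fin.cast eq s)) ≈ det R n A
  det-cast ≡.refl A = det-cong λ r s → reflexive (cong₂ A (Finₚ.cast-is-id _ r) (Finₚ.cast-is-id _ s))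

  module _ (N : ℕ) (x : Carrier) (M : Mat (N ℕ.+ N)) where

    reducedEntry : ℕ → Fin (N ℕ.+ N) → Fin N → Carrier
    reducedEntry k r j = if does (toℕ j <? k) then M r (N ↑ʳ j) - x * M r (j ↑ˡ N) else M r (N ↑ʳ j)

    reduceRight : ℕ → Mat (N ℕ.+ N)
    reduceRight k r s = [ (λ _ → M r s) , reducedEntry k r ]′ (splitAt N s)

    reducedEntry-< : ∀ k {r j} → toℕ j < k → reducedEntry k r j ≡ M r (N ↑ʳ j) - x * M r (j ↑ˡ N)
    reducedEntry-< k {j = j} j<k rewrite dec-true (toℕ j <? k) j<k = ≡.refl

    reducedEntry-≮ : ∀ k {r j} → ¬ toℕ j < k → reducedEntry k r j ≡ M r (N ↑ʳ j)
    reducedEntry-≮ k {j = j} j≮k rewrite dec-false (toℕ j <? k) j≮k = ≡.refl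

    reducedEntry-suc : ∀ k {r j} → toℕ j ≢ k → reducedEntry (suc k) r j ≡ reducedEntry k r j
    reducedEntry-suc k j≢k rewrite <-suc-≢ j≢k = ≡.refl

    reduceRight-↑ˡ : ∀ k r j → reduceRight k r (j ↑ˡ N) ≡ M r (j ↑ˡ N)
    reduceRight-↑ˡ k r j rewrite Finₚ.splitAt-↑ˡ N j N = ≡.refl

    reduceRight-↑ʳ : ∀ k r j → reduceRight k r (N ↑ʳ j) ≡ reducedEntry k r j
    reduceRight-↑ʳ k r j rewrite Finₚ.splitAt-↑ʳ N N j = ≡.refl

    reduceRight-zero : ∀ r s → reduceRight 0 r s ≡ M r s
    reduceRight-zero r s with ↑-cases N s
    ... | inj₁ (i , ≡.refl) = reduceRight-↑ˡ 0 r i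
    ... | inj₂ (j , ≡.refl) = ≡.trans (reduceRight-↑ʳ 0 r j) (reducedEntry-≮ 0 ℕₚ.n≮0)

    det-reduceRight-step : ∀ j → det R (N ℕ.+ N) (reduceRight (suc (toℕ j))) ≈ det R (N ℕ.+ N) (reduceRight (toℕ j))
    det-reduceRight-step j = det-subtract-col (reduceRight (toℕ j)) (reduceRight (suc (toℕ j))) x (↑ʳ≢↑ˡ j j) off col
      where
      off : ∀ r s → s ≢ N ↑ʳ j → reduceRight (suc (toℕ j)) r s ≈ reduceRight (toℕ j) r s
      off r s s≢ with ↑-cases N s
      ... | inj₁ (i , ≡.refl) =
              reflexive (≡.trans (reduceRight-↑ˡ (suc (toℕ j)) r i) (≡.sym (reduceRight-↑ˡ (toℕ j) r i)))
      ... | inj₂ (i , ≡.refl) = reflexive (≡.trans (reduceRight-↑ʳ (suc (toℕ j)) r i) (≡.trans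
              (reducedEntry-suc (toℕ j) λ i≡j → s≢ (cong (N ↑ʳ_) (Finₚ.toℕ-injective i≡j)))
              (≡.sym (reduceRight-↑ʳ (toℕ j) r i))))
      col : ∀ r → reduceRight (suc (toℕ j)) r (N ↑ʳ j) ≈
                  reduceRight (toℕ j) r (N ↑ʳ j) - x * reduceRight (toℕ j) r (j ↑ˡ N)
      col r = reflexive (≡.trans (reduceRight-↑ʳ (suc (toℕ j)) r j) (≡.trans (reducedEntry-< (suc (toℕ j)) (ℕₚ.n<1+n _))
        (≡.sym (cong₂ (λ a b → a - x * b)
          (≡.trans (reduceRight-↑ʳ (toℕ j) r j) (reducedEntry-≮ (toℕ j) (ℕₚ.<-irrefl ≡.refl)))
          (reduceRight-↑ˡ (toℕ j) r j)))))

    det-reduceRight : ∀ k → k ≤ N → det R (N ℕ.+ N) (reduceRight k) ≈ det R (N ℕ.+ N) M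
    det-reduceRight zero _ = det-cong λ r s → reflexive (reduceRight-zero r s)
    det-reduceRight (suc k) k<N = trans
      (≡.subst (λ k → det R (N ℕ.+ N) (reduceRight (suc k)) ≈ det R (N ℕ.+ N) (reduceRight k))
               (Finₚ.toℕ-fromℕ< k<N) (det-reduceRight-step (fromℕ< k<N)))
      (det-reduceRight k (ℕₚ.<⇒≤ k<N))

  det-scaledBlocks : ∀ N (A B : Mat N) (x y : Carrier) (M : Mat (N ℕ.+ N)) →
    (∀ i j → M (i ↑ˡ N) (j ↑ˡ N) ≈ A i j) → (∀ i j → M (i ↑ˡ N) (N ↑ʳ j) ≈ x * A i j) →
    (∀ i j → M (N ↑ʳ i) (j ↑ˡ N) ≈ B i j) → (∀ i j → M (N ↑ʳ i) (N ↑ʳ j) ≈ y * B i j) →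
    det R (N ℕ.+ N) M ≈ pow R (y - x) N * (det R N A * det R N B)
  det-scaledBlocks N A B x y M TL TR BL BR = begin
    det R (N ℕ.+ N) M                                       ≈⟨ sym (det-reduceRight N x M N ℕₚ.≤-refl) ⟩
    det R (N ℕ.+ N) M′                                      ≈⟨ det-blockTriangular N N M′ topRight ⟩
    det R N (λ i j → M′ (i ↑ˡ N) (j ↑ˡ N)) * det R N (λ i j → M′ (N ↑ʳ i) (N ↑ʳ j))
                                                            ≈⟨ *-cong (det-cong left) (trans (det-cong right) (det-scale (y - x) B)) ⟩
    det R N A * (pow R (y - x) N * det R N B)               ≈⟨ solve 3 (λ a p b → a :* (p :* b) := p :* (a :* b)) refl _ _ _ ⟩
    pow R (y - x) N * (det R N A * det R N B)               ∎
    where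
    M′ = reduceRight N x M N
    reduced : ∀ r j → M′ r (N ↑ʳ j) ≡ M r (N ↑ʳ j) - x * M r (j ↑ˡ N)
    reduced r j = ≡.trans (reduceRight-↑ʳ N x M N r j) (reducedEntry-< N x M N (Finₚ.toℕ<n j))
    topRight : ∀ i j → M′ (i ↑ˡ N) (N ↑ʳ j) ≈ 0#
    topRight i j = trans (reflexive (reduced _ j)) (trans (+-cong (TR i j) (-‿cong (*-congˡ (TL i j)))) (-‿inverseʳ _))
    left : ∀ i j → M′ (i ↑ˡ N) (j ↑ˡ N) ≈ A i j
    left i j = trans (reflexive (reduceRight-↑ˡ N x M N _ j)) (TL i j)
    right : ∀ i j → M′ (N ↑ʳ i) (N ↑ʳ j) ≈ (y - x) * B i j
    right i j = trans (reflexive (reduced _ j)) (trans (+-cong (BR i j) (-‿cong (*-congˡ (BL i j)))) (sym ([y-z]x≈yx-zx _ y x)))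

cornerExponent : ℕ → ℕ → ℕ → ℕ
cornerExponent m zero    zero    = 2 ℕ.^ m
cornerExponent m zero    (suc j) = 0
cornerExponent m (suc i) j       = 0

shiftRight : (ℕ → ℕ → ℕ) → ℕ → ℕ → ℕ
shiftRight E i zero    = 0
shiftRight E i (suc j) = E i j

shiftDown : (ℕ → ℕ → ℕ) → ℕ → ℕ → ℕ
shiftDown E zero    j = 0
shiftDown E (suc i) j = E i j

-- exponent m i j is the multiplicity of t_{a+1+i,b+1+j} - q_{a+1+i,b+1+j} in det K(a,b,m);
-- the recursion mirrors the block decomposition of K(a,b,m+1).
exponent : ℕ → ℕ → ℕ → ℕ
exponent zero    i j = 0
exponent (suc m) i j = cornerExponent m i j ℕ.+ (shiftRight (exponent m) i j ℕ.+ shiftDown (exponent m) i j)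

exponent-vanishes : ∀ m i j → m ≤ i ℕ.+ j → exponent m i j ≡ 0
exponent-vanishes zero          i       j       _         = ≡.refl
exponent-vanishes (suc m)       zero    (suc j) (s≤s m≤j) = cong (ℕ._+ 0) (exponent-vanishes m zero j m≤j)
exponent-vanishes (suc m)       (suc i) zero    (s≤s m≤i) = exponent-vanishes m i zero m≤i
exponent-vanishes (suc m)       (suc i) (suc j) (s≤s m≤i+1+j) =
  cong₂ ℕ._+_ (exponent-vanishes m (suc i) j (≡.subst (m ≤_) (ℕₚ.+-suc i j) m≤i+1+j))
              (exponent-vanishes m i (suc j) m≤i+1+j)

exponent-closedForm : ∀ m i j → i ℕ.+ j < m → exponent m i j ≡ ((i ℕ.+ j) choose i) ℕ.* 2 ℕ.^ (m ∸ suc (i ℕ.+ j))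
exponent-closedForm (suc m) zero    zero    _         = ≡.refl
exponent-closedForm (suc m) zero    (suc j) (s≤s j<m) = ≡.trans (ℕₚ.+-identityʳ _) (exponent-closedForm m zero j j<m)
exponent-closedForm (suc m) (suc i) zero    (s≤s i<m) =
  ≡.trans (exponent-closedForm m i zero i<m) (cong (ℕ._* 2 ℕ.^ (m ∸ suc (i ℕ.+ 0))) diagonal)
  where
  diagonal : (i ℕ.+ 0) choose i ≡ suc (i ℕ.+ 0) choose suc i
  diagonal rewrite ℕₚ.+-identityʳ i = ≡.trans (nCn≡1 i) (≡.sym (nCn≡1 (suc i)))
exponent-closedForm (suc m) (suc i) (suc j) (s≤s i+1+j<m) = begin
  exponent m (suc i) j ℕ.+ exponent m i (suc j)
    ≡⟨ cong₂ ℕ._+_ (exponent-closedForm m (suc i) j (≡.subst (_< m) (ℕₚ.+-suc i j) i+1+j<m))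
                   (exponent-closedForm m i (suc j) i+1+j<m) ⟩
  (suc k choose suc i) ℕ.* p ℕ.+ ((i ℕ.+ suc j) choose i) ℕ.* 2 ℕ.^ (m ∸ suc (i ℕ.+ suc j))
    ≡⟨ cong (λ n → (suc k choose suc i) ℕ.* p ℕ.+ (n choose i) ℕ.* 2 ℕ.^ (m ∸ suc n)) (ℕₚ.+-suc i j) ⟩
  (suc k choose suc i) ℕ.* p ℕ.+ (suc k choose i) ℕ.* p
    ≡⟨ ≡.sym (ℕₚ.*-distribʳ-+ p (suc k choose suc i) (suc k choose i)) ⟩
  ((suc k choose suc i) ℕ.+ (suc k choose i)) ℕ.* p
    ≡⟨ cong (ℕ._* p) (≡.trans (ℕₚ.+-comm (suc k choose suc i) _) (nCk+nC[k+1]≡[n+1]C[k+1] (suc k) i)) ⟩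
  (suc (suc k) choose suc i) ℕ.* p
    ≡⟨ cong (λ n → (suc n choose suc i) ℕ.* 2 ℕ.^ (m ∸ suc n)) (≡.sym (ℕₚ.+-suc i j)) ⟩
  (suc (i ℕ.+ suc j) choose suc i) ℕ.* 2 ℕ.^ (m ∸ suc (i ℕ.+ suc j)) ∎
  where
  open ≡.≡-Reasoning
  k = i ℕ.+ j
  p = 2 ℕ.^ (m ∸ suc (suc k))

module PowerGrid {c ℓ : Level} (R : CommutativeRing c ℓ) where
  open CommutativeRing R
  open import Algebra.Properties.CommutativeMonoid.Sum *-commutativeMonoid
    public using () renaming (sum to prod; sum-cong-≋ to prod-cong; sum-cong-≗ to prod-cong-≡;
                              ∑-distrib-+ to prod-distrib-*; sum-replicate-zero to prod-replicate-one)
  open import Relation.Binary.Reasoning.Setoid setoid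

  pow-+ : ∀ x m n → pow R x (m ℕ.+ n) ≈ pow R x m * pow R x n
  pow-+ x zero    n = sym (*-identityˡ _)
  pow-+ x (suc m) n = trans (*-congˡ (pow-+ x m n)) (sym (*-assoc _ _ _))

  prod-one : ∀ {n} {f : Fin n → Carrier} → (∀ i → f i ≈ 1#) → prod f ≈ 1#
  prod-one {n} f≈1 = trans (prod-cong f≈1) (prod-replicate-one n)

  prodL-map-++ : ∀ {X : Set} (φ : X → Carrier) xs ys →
                 prodL R (List.map φ (xs ++ ys)) ≈ prodL R (List.map φ xs) * prodL R (List.map φ ys)
  prodL-map-++ φ []       ys = sym (*-identityˡ _)
  prodL-map-++ φ (x ∷ xs) ys = trans (*-congˡ (prodL-map-++ φ xs ys)) (sym (*-assoc _ _ _))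

  prodL-map-concatMap : ∀ {X Y : Set} (φ : Y → Carrier) (f : X → List Y) xs →
    prodL R (List.map φ (concatMap f xs)) ≈ prodL R (List.map (λ x → prodL R (List.map φ (f x))) xs)
  prodL-map-concatMap φ f []       = refl
  prodL-map-concatMap φ f (x ∷ xs) = trans (prodL-map-++ φ (f x) (concatMap f xs)) (*-congˡ (prodL-map-concatMap φ f xs))

  prodL-map-applyUpTo : ∀ {X : Set} (φ : X → Carrier) (f : ℕ → X) n →
                        prodL R (List.map φ (applyUpTo f n)) ≡ prod {n} (λ i → φ (f (toℕ i)))
  prodL-map-applyUpTo φ f zero    = ≡.refl
  prodL-map-applyUpTo φ f (suc n) = cong (φ (f 0) *_) (prodL-map-applyUpTo φ (f ∘ suc) n)

  powerGrid : ℕ → ℕ → (ℕ → ℕ → Carrier) → (ℕ → ℕ → ℕ) → Carrier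
  powerGrid I J h E = prod {I} λ i → prod {J} λ j → pow R (h (toℕ i) (toℕ j)) (E (toℕ i) (toℕ j))

  powerGrid-cong : ∀ I J {h h′} E → (∀ i j → h i j ≡ h′ i j) → powerGrid I J h E ≡ powerGrid I J h′ E
  powerGrid-cong I J E h≡h′ =
    prod-cong-≡ {I} λ i → prod-cong-≡ {J} λ j → cong (λ x → pow R x (E (toℕ i) (toℕ j))) (h≡h′ (toℕ i) (toℕ j))

  powerGrid-zero : ∀ I J h → powerGrid I J h (λ _ _ → 0) ≈ 1#
  powerGrid-zero I J h = prod-one {I} λ i → prod-one {J} λ j → refl

  powerGrid-+ : ∀ I J h (E E′ : ℕ → ℕ → ℕ) →
    powerGrid I J h (λ i j → E i j ℕ.+ E′ i j) ≈ powerGrid I J h E * powerGrid I J h E′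
  powerGrid-+ I J h E E′ = trans
    (prod-cong {I} λ i → trans (prod-cong {J} λ j → pow-+ _ (E (toℕ i) (toℕ j)) (E′ (toℕ i) (toℕ j)))
                               (prod-distrib-* (entry E i) (entry E′ i)))
    (prod-distrib-* (λ i → prod (entry E i)) (λ i → prod (entry E′ i)))
    where
    entry : (ℕ → ℕ → ℕ) → Fin I → Fin J → Carrier
    entry F i j = pow R (h (toℕ i) (toℕ j)) (F (toℕ i) (toℕ j))

  powerGrid-corner : ∀ m I J h → powerGrid (suc I) (suc J) h (cornerExponent m) ≈ pow R (h 0 0) (2 ℕ.^ m)
  powerGrid-corner m I J h = begin
    (pow R (h 0 0) (2 ℕ.^ m) * prod {J} (λ _ → 1#)) * prod {I} (λ _ → prod {suc J} (λ _ → 1#))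
      ≈⟨ *-cong (*-congˡ (prod-one {J} λ _ → refl)) (prod-one {I} λ _ → prod-one {suc J} λ _ → refl) ⟩
    (pow R (h 0 0) (2 ℕ.^ m) * 1#) * 1#
      ≈⟨ trans (*-identityʳ _) (*-identityʳ _) ⟩
    pow R (h 0 0) (2 ℕ.^ m) ∎

  powerGrid-shiftRight : ∀ I J h E → powerGrid I (suc J) h (shiftRight E) ≈ powerGrid I J (λ i j → h i (suc j)) E
  powerGrid-shiftRight I J h E = prod-cong {I} λ i → *-identityˡ _

  powerGrid-shiftDown : ∀ I J h E → powerGrid (suc I) J h (shiftDown E) ≈ powerGrid I J (λ i j → h (suc i) j) E
  powerGrid-shiftDown I J h E = trans (*-congʳ (prod-one {J} λ _ → refl)) (*-identityˡ _)

module KostkaDeterminant {c ℓ : Level} (R : CommutativeRing c ℓ) (q t : ℕ → ℕ → CommutativeRing.Carrier R) where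
  open CommutativeRing R hiding (zero)
  open Determinant R
  open PowerGrid R
  open import Relation.Binary.Reasoning.Setoid setoid

  shiftedKostka : ℕ → ℕ → (m : ℕ) → Mat (2 ℕ.^ m)
  shiftedKostka a b m r s = kEntry R q t a b (Vec.lookup (allWords m) r) (Vec.lookup (allWords m) s)

  Δ : ℕ → ℕ → Carrier
  Δ x y = t x y - q x y

  δ : ℕ → ℕ → ℕ → ℕ → Carrier
  δ a b i j = Δ (suc (a ℕ.+ i)) (suc (b ℕ.+ j))

  det-shiftedKostka-suc : ∀ m a b → det R (2 ℕ.^ suc m) (shiftedKostka a b (suc m)) ≈
    pow R (Δ (suc a) (suc b)) (2 ℕ.^ m) *
      (det R (2 ℕ.^ m) (shiftedKostka a (suc b) m) * det R (2 ℕ.^ m) (shiftedKostka (suc a) b m))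
  det-shiftedKostka-suc m a b = begin
    det R (N ℕ.+ (N ℕ.+ 0)) (shiftedKostka a b (suc m))
      ≈⟨ det-cong {N ℕ.+ (N ℕ.+ 0)} (λ r s → reflexive (cong₂ (kEntry R q t a b)
                                         (Vecₚ.lookup-cast₁ _ words r) (Vecₚ.lookup-cast₁ _ words s))) ⟩
    det R (N ℕ.+ (N ℕ.+ 0)) (λ r s → M (Fin.cast N+N+0≡N+N r) (Fin.cast N+N+0≡N+N s))
      ≈⟨ det-cast N+N+0≡N+N M ⟩
    det R (N ℕ.+ N) M
      ≈⟨ det-scaledBlocks N (shiftedKostka a (suc b) m) (shiftedKostka (suc a) b m) _ _ M
           (λ i j → trans (reflexive (cong₂ (kEntry R q t a b) (word-↑ˡ i) (word-↑ˡ j))) (*-identityˡ _))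
           (λ i j → reflexive (cong₂ (kEntry R q t a b) (word-↑ˡ i) (word-↑ʳ j)))
           (λ i j → trans (reflexive (cong₂ (kEntry R q t a b) (word-↑ʳ i) (word-↑ˡ j))) (*-identityˡ _))
           (λ i j → reflexive (cong₂ (kEntry R q t a b) (word-↑ʳ i) (word-↑ʳ j))) ⟩
    pow R (Δ (suc a) (suc b)) N * (det R N (shiftedKostka a (suc b) m) * det R N (shiftedKostka (suc a) b m)) ∎
    where
    N = 2 ℕ.^ m
    startingWith0 startingWith1 : Vec.Vec (Vec.Vec Bool (suc m)) N
    startingWith0 = Vec.map (false Vec.∷_) (allWords m)
    startingWith1 = Vec.map (true Vec.∷_) (allWords m)
    words = startingWith0 Vec.++ startingWith1
    M : Mat (N ℕ.+ N)
    M r s = kEntry R q t a b (Vec.lookup words r) (Vec.lookup words s)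
    N+N+0≡N+N : N ℕ.+ (N ℕ.+ 0) ≡ N ℕ.+ N
    N+N+0≡N+N = cong (N ℕ.+_) (ℕₚ.+-identityʳ N)
    word-↑ˡ : ∀ i → Vec.lookup words (i ↑ˡ N) ≡ false Vec.∷ Vec.lookup (allWords m) i
    word-↑ˡ i = ≡.trans (Vecₚ.lookup-++ˡ startingWith0 startingWith1 i) (Vecₚ.lookup-map i (false Vec.∷_) (allWords m))
    word-↑ʳ : ∀ i → Vec.lookup words (N ↑ʳ i) ≡ true Vec.∷ Vec.lookup (allWords m) i
    word-↑ʳ i = ≡.trans (Vecₚ.lookup-++ʳ startingWith0 startingWith1 i) (Vecₚ.lookup-map i (true Vec.∷_) (allWords m))

  -- The grid only has to be large enough; leaving its size free lets the two recursive calls,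
  -- whose grids are shifted in different directions, share one induction.
  det-shiftedKostka : ∀ m a b I J → m ≤ I → m ≤ J →
                      det R (2 ℕ.^ m) (shiftedKostka a b m) ≈ powerGrid I J (δ a b) (exponent m)
  det-shiftedKostka zero a b I J _ _ =
    trans (+-identityʳ _) (trans (*-identityˡ _) (trans (*-identityˡ _) (sym (powerGrid-zero I J (δ a b)))))
  det-shiftedKostka (suc m) a b (suc I) (suc J) (s≤s m≤I) (s≤s m≤J) = begin
    det R (2 ℕ.^ suc m) (shiftedKostka a b (suc m))
      ≈⟨ det-shiftedKostka-suc m a b ⟩
    pow R (Δ (suc a) (suc b)) (2 ℕ.^ m) *
      (det R (2 ℕ.^ m) (shiftedKostka a (suc b) m) * det R (2 ℕ.^ m) (shiftedKostka (suc a) b m))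
      ≈⟨ *-cong corner (*-cong (det-shiftedKostka m a (suc b) (suc I) J (ℕₚ.m≤n⇒m≤1+n m≤I) m≤J)
                               (det-shiftedKostka m (suc a) b I (suc J) m≤I (ℕₚ.m≤n⇒m≤1+n m≤J))) ⟩
    G (cornerExponent m) * (powerGrid (suc I) J (δ a (suc b)) E * powerGrid I (suc J) (δ (suc a) b) E)
      ≈⟨ *-congˡ (sym (*-cong right down)) ⟩
    G (cornerExponent m) * (G (shiftRight E) * G (shiftDown E))
      ≈⟨ sym (trans (powerGrid-+ (suc I) (suc J) (δ a b) (cornerExponent m) (λ i j → shiftRight E i j ℕ.+ shiftDown E i j))
                    (*-congˡ (powerGrid-+ (suc I) (suc J) (δ a b) (shiftRight E) (shiftDown E)))) ⟩
    G (exponent (suc m)) ∎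
    where
    E = exponent m
    G = powerGrid (suc I) (suc J) (δ a b)
    corner : pow R (Δ (suc a) (suc b)) (2 ℕ.^ m) ≈ G (cornerExponent m)
    corner = sym (trans (powerGrid-corner m I J (δ a b))
      (reflexive (cong₂ (λ x y → pow R (Δ (suc x) (suc y)) (2 ℕ.^ m)) (ℕₚ.+-identityʳ a) (ℕₚ.+-identityʳ b))))
    right : G (shiftRight E) ≈ powerGrid (suc I) J (δ a (suc b)) E
    right = trans (powerGrid-shiftRight (suc I) J (δ a b) E)
      (reflexive (powerGrid-cong (suc I) J E λ i j → cong (λ z → Δ (suc (a ℕ.+ i)) (suc z)) (ℕₚ.+-suc b j)))
    down : G (shiftDown E) ≈ powerGrid I (suc J) (δ (suc a) b) E
    down = trans (powerGrid-shiftDown I (suc J) (δ a b) E)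
      (reflexive (powerGrid-cong I (suc J) E λ i j → cong (λ z → Δ (suc z) (suc (b ℕ.+ j))) (ℕₚ.+-suc a i)))

  rhsFactor : ℕ → ℕ × ℕ → Carrier
  rhsFactor n p = pow R (Δ (proj₁ p) (proj₂ p)) (expo R n (proj₁ p) (proj₂ p))

  rhs-entry : ∀ m i j →
    prodL R (List.map (rhsFactor (suc m)) (if suc i ℕ.+ suc j ≤ᵇ suc m then (suc i , suc j) ∷ [] else []))
      ≈ pow R (δ 0 0 i j) (exponent m i j)
  rhs-entry m i j with suc i ℕ.+ suc j ≤ᵇ suc m in fits
  ... | true  = trans (*-identityʳ _) (reflexive (cong (pow R (δ 0 0 i j)) (≡.sym (≡.trans
                  (exponent-closedForm m i j i+j<m)
                  (cong (λ n → ((n ∸ 1) choose i) ℕ.* 2 ℕ.^ (m ∸ n)) (≡.sym (ℕₚ.+-suc i j)))))))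
    where
    i+j<m : i ℕ.+ j < m
    i+j<m = ≡.subst (_≤ m) (ℕₚ.+-suc i j)
                    (ℕ.s≤s⁻¹ (ℕₚ.≤ᵇ⇒≤ (suc i ℕ.+ suc j) (suc m) (≡.subst T (≡.sym fits) tt)))
  ... | false = reflexive (cong (pow R (δ 0 0 i j)) (≡.sym (exponent-vanishes m i j (ℕₚ.≮⇒≥ i+j≮m))))
    where
    i+j≮m : ¬ i ℕ.+ j < m
    i+j≮m i+j<m = ≡.subst T fits (ℕₚ.≤⇒≤ᵇ (s≤s (≡.subst (_≤ m) (≡.sym (ℕₚ.+-suc i j)) i+j<m)))

  rhs≈powerGrid : ∀ m → rhs R q t (suc m) ≈ powerGrid (suc m) (suc m) (δ 0 0) (exponent m)
  rhs≈powerGrid m = begin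
    rhs R q t (suc m)
      ≈⟨ prodL-map-concatMap φ row (List.upTo (suc m)) ⟩
    prodL R (List.map (λ i → prodL R (List.map φ (row i))) (List.upTo (suc m)))
      ≡⟨ prodL-map-applyUpTo (λ i → prodL R (List.map φ (row i))) (λ i → i) (suc m) ⟩
    prod {suc m} (λ i → prodL R (List.map φ (row (toℕ i))))
      ≈⟨ prod-cong {suc m} (λ i → trans (prodL-map-concatMap φ (cell (toℕ i)) (List.upTo (suc m)))
                                        (reflexive (prodL-map-applyUpTo _ (λ j → j) (suc m)))) ⟩
    prod {suc m} (λ i → prod {suc m} (λ j → prodL R (List.map φ (cell (toℕ i) (toℕ j)))))
      ≈⟨ prod-cong {suc m} (λ i → prod-cong {suc m} (λ j → rhs-entry m (toℕ i) (toℕ j))) ⟩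
    powerGrid (suc m) (suc m) (δ 0 0) (exponent m) ∎
    where
    φ = rhsFactor (suc m)
    cell : ℕ → ℕ → List (ℕ × ℕ)
    cell i j = if suc i ℕ.+ suc j ≤ᵇ suc m then (suc i , suc j) ∷ [] else []
    row : ℕ → List (ℕ × ℕ)
    row i = concatMap (cell i) (List.upTo (suc m))

mainTheorem1 : {c ℓ : Level} (R : CommutativeRing c ℓ) →
               (q t : ℕ → ℕ → CommutativeRing.Carrier R) →
               (n : ℕ) → 1 ≤ n →
               CommutativeRing._≈_ R (det R (2 Data.Nat.^ (n ∸ 1)) (Kostka R q t (n ∸ 1))) (rhs R q t n)
mainTheorem1 R q t (suc m) _ = begin
  det R (2 ℕ.^ m) (Kostka R q t m)
    ≈⟨ det-shiftedKostka m 0 0 (suc m) (suc m) (ℕₚ.n≤1+n m) (ℕₚ.n≤1+n m) ⟩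
  powerGrid (suc m) (suc m) (δ 0 0) (exponent m)
    ≈⟨ sym (rhs≈powerGrid m) ⟩
  rhs R q t (suc m) ∎
  where
  open CommutativeRing R using (setoid; sym)
  open import Relation.Binary.Reasoning.Setoid setoid
  open PowerGrid R using (powerGrid)
  open KostkaDeterminant R q t
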